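{- Let $S$ be a Kleene relation algebra satisfying the Tarski rule, let $p \in S$ be such that $p \sqcap \overline{1}$ is acyclic, and let $w, y \in S$ be points with $y \sqsubseteq (p^T)^*\cdot w$. Then $\big((w \sqcap y^T) \sqcup (\overline{w} \sqcap p)\big) \sqcap \overline{1}$ is acyclic.
   Context: A Kleene relation algebra is a structure $(S,\sqcup,\sqcap,\cdot,\overline{\phantom{x}},{}^T,{}^*,\bot,\top,1)$ such that $(S,\sqcup,\sqcap,\overline{\phantom{x}},\bot,\top)$ is a Boolean algebra with order $x \sqsubseteq y \iff x \sqcup y = y$; $(S,\sqcup,\cdot,\bot,1)$ is an idempotent semiring ($\cdot$ associative with two-sided unit $1$, distributing over $\sqcup$, $\bot$ a two-sided zero of $\cdot$); transposition satisfies $(x\sqcup y)^T = x^T \sqcup y^T$, $(x^T)^T = x$, $(x\cdot y)^T = y^T\cdot x^T$ and $(x\cdot y)\sqcap z \sqsubseteq x\cdot(y\sqcap(x^T\cdot z))$; and the star satisfies $1\sqcup y\cdot y^* = y^* = 1 \sqcup y^*\cdot y$, $z\sqcup y\cdot x\sqsubseteq x \Rightarrow y^*\cdot z\sqsubseteq x$, $z \sqcup x\cdot y \sqsubseteq x \Rightarrow z\cdot y^*\sqsubseteq x$. The Tarski rule states $\top\cdot x\cdot\top = \top$ for every $x \neq \bot$. Write $x^+ = x\cdot x^*$. An element $x$ is acyclic if $x^+\sqsubseteq \overline{1}$, injective if $x x^T\sqsubseteq 1$, surjective if $1\sqsubseteq x^T x$, a vector if $x\cdot\top = x$, and a point if it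 is an injective surjective vector. -}

module Defs where

open import Level using (Level; suc)
open import Relation.Binary.PropositionalEquality using (_≡_)
open import Relation.Nullary using (¬_)
open import Data.Product using (_×_)
open import Algebra.Core using (Op₁; Op₂)
open import Algebra.Lattice.Structures using (IsBooleanAlgebra)

record KleeneRelationAlgebra (c : Level) : Set (suc c) where
  infixr 6 _⊔_
  infixr 7 _⊓_
  infixr 8 _·_
  field
    S    : Set c
    _⊔_  : Op₂ S
    _⊓_  : Op₂ S
    _·_  : Op₂ S
    ∁    : Op₁ S
    _ᵀ   : Op₁ S
    _*   : Op₁ S
    bot  : S
    top  : S
    one  : S

  _⊑_ : S → S → Set c
  x ⊑ y = (x ⊔ y) ≡ y

  field
    isBooleanAlgebra : IsBooleanAlgebra _≡_ _⊔_ _⊓_ ∁ top bot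
    -- idempotent semiring (S, ⊔, ·, bot, one); ⊔ is assoc/comm/idempotent by the lattice
    ·-assoc     : ∀ x y z → (x · y) · z ≡ x · (y · z)
    ·-identityˡ : ∀ x → one · x ≡ x
    ·-identityʳ : ∀ x → x · one ≡ x
    ·-distribˡ  : ∀ x y z → x · (y ⊔ z) ≡ (x · y) ⊔ (x · z)
    ·-distribʳ  : ∀ x y z → (y ⊔ z) · x ≡ (y · x) ⊔ (z · x)
    ⊔-identityˡ : ∀ x → bot ⊔ x ≡ x
    ·-zeroˡ     : ∀ x → bot · x ≡ bot
    ·-zeroʳ     : ∀ x → x · bot ≡ bot
    ᵀ-⊔         : ∀ x y → (x ⊔ y) ᵀ ≡ (x ᵀ) ⊔ (y ᵀ)
    ᵀ-involutive : ∀ x → (x ᵀ) ᵀ ≡ x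
    ᵀ-·         : ∀ x y → (x · y) ᵀ ≡ (y ᵀ) · (x ᵀ)
    dedekind    : ∀ x y z → ((x · y) ⊓ z) ⊑ (x · (y ⊓ ((x ᵀ) · z)))
    star-unfoldˡ : ∀ y → (one ⊔ (y · (y *))) ≡ y *
    star-unfoldʳ : ∀ y → (one ⊔ ((y *) · y)) ≡ y *
    star-inductˡ : ∀ x y z → (z ⊔ (y · x)) ⊑ x → ((y *) · z) ⊑ x
    star-inductʳ : ∀ x y z → (z ⊔ (x · y)) ⊑ x → (z · (y *)) ⊑ x

  _⁺ : Op₁ S
  x ⁺ = x · (x *)

  acyclic : S → Set c
  acyclic x = (x ⁺) ⊑ ∁ one

  injective : S → Set c
  injective x = (x · (x ᵀ)) ⊑ one

  surjective : S → Set c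
  surjective x = one ⊑ ((x ᵀ) · x)

  vector : S → Set c
  vector x = x · top ≡ x

  point : S → Set c
  point x = injective x × surjective x × vector x

  tarski : Set c
  tarski = ∀ x → ¬ (x ≡ bot) → (top · x) · top ≡ top

-- Put r = p ⊓ ∁ one. Every edge of q = ((w ⊓ yᵀ) ⊔ (∁ w ⊓ p)) ⊓ ∁ one lies in r⁺:
-- the vectors w and y give w ⊓ yᵀ ⊑ w · yᵀ ⊑ w · wᵀ · p* ⊑ p* ⊑ r*, whose
-- off-diagonal part is r⁺, while ∁ w ⊓ p ⊓ ∁ one ⊑ r. As r⁺ is transitive,
-- q⁺ ⊑ r⁺ ⊑ ∁ one.
module Submission where

open import Level using (Level)
open import Defs
open import Relation.Binary.PropositionalEquality
open import Data.Product using (_,_)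
open import Algebra.Lattice.Bundles using (BooleanAlgebra)
open import Algebra.Lattice.Structures using (IsBooleanAlgebra)
import Algebra.Lattice.Properties.BooleanAlgebra as BooleanAlgebraProperties

module KleeneRelationAlgebraProperties {c : Level} (K : KleeneRelationAlgebra c) where
  open KleeneRelationAlgebra K public
    renaming (_⊑_ to infix 4 _⊑_; _ᵀ to infix 10 _ᵀ; _* to infix 10 _*; _⁺ to infix 10 _⁺)
  open IsBooleanAlgebra isBooleanAlgebra
    using (∨-comm; ∨-assoc; ∧-comm; ∨-absorbs-∧; ∨-distribˡ-∧;
           ∧-distribˡ-∨; ∧-distribʳ-∨; ∧-complementʳ; ∨-complementʳ)

  booleanAlgebra : BooleanAlgebra c c
  booleanAlgebra = record { isBooleanAlgebra = isBooleanAlgebra }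

  open BooleanAlgebraProperties booleanAlgebra
    using (∨-idem; ∨-zeroʳ; ∧-identityʳ)

  ⊑-refl : ∀ x → x ⊑ x
  ⊑-refl = ∨-idem

  ⊑-reflexive : ∀ {x y} → x ≡ y → x ⊑ y
  ⊑-reflexive {x} refl = ⊑-refl x

  ⊑-trans : ∀ {x y z} → x ⊑ y → y ⊑ z → x ⊑ z
  ⊑-trans {x} {y} {z} x⊑y y⊑z = begin
    x ⊔ z        ≡⟨ cong (x ⊔_) (sym y⊑z) ⟩
    x ⊔ (y ⊔ z)  ≡⟨ sym (∨-assoc x y z) ⟩
    (x ⊔ y) ⊔ z  ≡⟨ cong (_⊔ z) x⊑y ⟩
    y ⊔ z        ≡⟨ y⊑z ⟩
    z            ∎
    where open ≡-Reasoning

  bot-least : ∀ x → bot ⊑ x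
  bot-least = ⊔-identityˡ

  ⊑-top : ∀ x → x ⊑ top
  ⊑-top = ∨-zeroʳ

  ⊔-upperˡ : ∀ x y → x ⊑ x ⊔ y
  ⊔-upperˡ x y = trans (sym (∨-assoc x x y)) (cong (_⊔ y) (∨-idem x))

  ⊔-upperʳ : ∀ x y → y ⊑ x ⊔ y
  ⊔-upperʳ x y = subst (y ⊑_) (∨-comm y x) (⊔-upperˡ y x)

  ⊔-lub : ∀ {x y z} → x ⊑ z → y ⊑ z → x ⊔ y ⊑ z
  ⊔-lub {x} {y} {z} x⊑z y⊑z = trans (∨-assoc x y z) (trans (cong (x ⊔_) y⊑z) x⊑z)

  ⊓-lowerˡ : ∀ x y → x ⊓ y ⊑ x
  ⊓-lowerˡ x y = trans (∨-comm (x ⊓ y) x) (∨-absorbs-∧ x y)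

  ⊓-lowerʳ : ∀ x y → x ⊓ y ⊑ y
  ⊓-lowerʳ x y = subst (_⊑ y) (∧-comm y x) (⊓-lowerˡ y x)

  ⊓-glb : ∀ {x y z} → z ⊑ x → z ⊑ y → z ⊑ x ⊓ y
  ⊓-glb {x} {y} {z} z⊑x z⊑y = trans (∨-distribˡ-∧ z x y) (cong₂ _⊓_ z⊑x z⊑y)

  ⊓-monoˡ : ∀ z {x y} → x ⊑ y → x ⊓ z ⊑ y ⊓ z
  ⊓-monoˡ z {x} x⊑y = ⊓-glb (⊑-trans (⊓-lowerˡ x z) x⊑y) (⊓-lowerʳ x z)

  ⊓-distribʳ-⊔ : ∀ z x y → (x ⊔ y) ⊓ z ≡ (x ⊓ z) ⊔ (y ⊓ z)
  ⊓-distribʳ-⊔ = ∧-distribʳ-∨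

  ⊑-one⊔-⊓∁one : ∀ x → x ⊑ one ⊔ (x ⊓ ∁ one)
  ⊑-one⊔-⊓∁one x = ⊑-trans (⊑-reflexive x≡) (⊔-lub (⊑-trans (⊓-lowerʳ x one) (⊔-upperˡ one _))
                                                  (⊔-upperʳ one _))
    where
    x≡ : x ≡ (x ⊓ one) ⊔ (x ⊓ ∁ one)
    x≡ = begin
      x                        ≡⟨ sym (∧-identityʳ x) ⟩
      x ⊓ top                  ≡⟨ cong (x ⊓_) (sym (∨-complementʳ one)) ⟩
      x ⊓ (one ⊔ ∁ one)        ≡⟨ ∧-distribˡ-∨ x one (∁ one) ⟩
      (x ⊓ one) ⊔ (x ⊓ ∁ one)  ∎
      where open ≡-Reasoning

  ·-monoˡ : ∀ z {x y} → x ⊑ y → x · z ⊑ y · z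
  ·-monoˡ z {x} {y} x⊑y = trans (sym (·-distribʳ z x y)) (cong (_· z) x⊑y)

  ·-monoʳ : ∀ z {x y} → x ⊑ y → z · x ⊑ z · y
  ·-monoʳ z {x} {y} x⊑y = trans (sym (·-distribˡ z x y)) (cong (z ·_) x⊑y)

  ᵀ-mono : ∀ {x y} → x ⊑ y → x ᵀ ⊑ y ᵀ
  ᵀ-mono {x} {y} x⊑y = trans (sym (ᵀ-⊔ x y)) (cong _ᵀ x⊑y)

  ᵀ⊑⇒⊑ᵀ : ∀ {x y} → x ᵀ ⊑ y → x ⊑ y ᵀ
  ᵀ⊑⇒⊑ᵀ {x} xᵀ⊑y = subst (_⊑ _) (ᵀ-involutive x) (ᵀ-mono xᵀ⊑y)

  oneᵀ : one ᵀ ≡ one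
  oneᵀ = begin
    one ᵀ                ≡⟨ sym (·-identityʳ (one ᵀ)) ⟩
    one ᵀ · one          ≡⟨ cong (one ᵀ ·_) (sym (ᵀ-involutive one)) ⟩
    one ᵀ · (one ᵀ) ᵀ    ≡⟨ sym (ᵀ-· (one ᵀ) one) ⟩
    (one ᵀ · one) ᵀ      ≡⟨ cong _ᵀ (·-identityʳ (one ᵀ)) ⟩
    (one ᵀ) ᵀ            ≡⟨ ᵀ-involutive one ⟩
    one                  ∎
    where open ≡-Reasoning

  top⊑topᵀ : top ⊑ top ᵀ
  top⊑topᵀ = ᵀ⊑⇒⊑ᵀ (⊑-top (top ᵀ))

  -- Dedekind with x := w, y := top, z := yᵀ; the vector property of y gives wᵀ · yᵀ ⊑ yᵀ.
  vector-⊓ᵀ⊑· : ∀ {w y} → vector w → vector y → w ⊓ y ᵀ ⊑ w · y ᵀ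
  vector-⊓ᵀ⊑· {w} {y} w-vec y-vec =
    ⊑-trans (subst (λ t → t ⊓ y ᵀ ⊑ w · (top ⊓ w ᵀ · y ᵀ)) w-vec (dedekind w top (y ᵀ)))
            (·-monoʳ w (⊑-trans (⊓-lowerʳ top (w ᵀ · y ᵀ)) wᵀyᵀ⊑yᵀ))
    where
    wᵀyᵀ⊑yᵀ : w ᵀ · y ᵀ ⊑ y ᵀ
    wᵀyᵀ⊑yᵀ = ⊑-trans (·-monoˡ (y ᵀ) (⊑-trans (⊑-top (w ᵀ)) top⊑topᵀ))
                      (⊑-reflexive (trans (sym (ᵀ-· y top)) (cong _ᵀ y-vec)))

  one⊑star : ∀ x → one ⊑ x *
  one⊑star x = subst (one ⊑_) (star-unfoldˡ x) (⊔-upperˡ one _)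

  plus⊑star : ∀ x → x ⁺ ⊑ x *
  plus⊑star x = subst (x ⁺ ⊑_) (star-unfoldˡ x) (⊔-upperʳ one _)

  star·⊑star : ∀ x → x * · x ⊑ x *
  star·⊑star x = subst (x * · x ⊑_) (star-unfoldʳ x) (⊔-upperʳ one _)

  star·star⊑star : ∀ x → x * · x * ⊑ x *
  star·star⊑star x = star-inductˡ (x *) x (x *) (⊔-lub (⊑-refl (x *)) (plus⊑star x))

  ⊑-plus : ∀ x → x ⊑ x ⁺
  ⊑-plus x = subst (_⊑ x ⁺) (·-identityʳ x) (·-monoʳ x (one⊑star x))

  plus·plus⊑plus : ∀ x → x ⁺ · x ⁺ ⊑ x ⁺
  plus·plus⊑plus x = subst (_⊑ x ⁺) (sym (·-assoc x (x *) (x ⁺)))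
    (·-monoʳ x (subst (_⊑ x *) (·-assoc (x *) x (x *))
                      (⊑-trans (·-monoˡ (x *) (star·⊑star x)) (star·star⊑star x))))

  plus-least : ∀ x {y} → y ⊑ x ⁺ → y ⁺ ⊑ x ⁺
  plus-least x {y} y⊑x⁺ =
    star-inductʳ (x ⁺) y y (⊔-lub y⊑x⁺ (⊑-trans (·-monoʳ (x ⁺) y⊑x⁺) (plus·plus⊑plus x)))

  star-⊓∁one⊑plus : ∀ x → x * ⊓ ∁ one ⊑ x ⁺
  star-⊓∁one⊑plus x = subst (λ t → t ⊓ ∁ one ⊑ x ⁺) (star-unfoldˡ x)
    (subst (_⊑ x ⁺) (sym (⊓-distribʳ-⊔ (∁ one) one (x ⁺)))
      (⊔-lub (subst (_⊑ x ⁺) (sym (∧-complementʳ one)) (bot-least (x ⁺)))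
             (⊓-lowerˡ (x ⁺) (∁ one))))

  star-⊑-one⊔ : ∀ {x y} → x ⊑ one ⊔ y → x * ⊑ y *
  star-⊑-one⊔ {x} {y} x⊑one⊔y =
    subst (_⊑ y *) (·-identityʳ (x *))
      (star-inductˡ (y *) x one (⊔-lub (one⊑star y) (⊑-trans (·-monoˡ (y *) x⊑one⊔y) one⊔y·star⊑star)))
    where
    one⊔y·star⊑star : (one ⊔ y) · y * ⊑ y *
    one⊔y·star⊑star = subst (_⊑ y *) (sym (·-distribʳ (y *) one y))
      (⊔-lub (⊑-reflexive (·-identityˡ (y *))) (plus⊑star y))

  star-⊑-star-⊓∁one : ∀ x → x * ⊑ (x ⊓ ∁ one) *
  star-⊑-star-⊓∁one x = star-⊑-one⊔ (⊑-one⊔-⊓∁one x)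

  starᵀ⊑ᵀstar : ∀ x → (x ᵀ) * ⊑ (x *) ᵀ
  starᵀ⊑ᵀstar x = subst (_⊑ (x *) ᵀ) (·-identityʳ ((x ᵀ) *))
    (star-inductˡ ((x *) ᵀ) (x ᵀ) one (⊑-reflexive unfold))
    where
    unfold : one ⊔ x ᵀ · (x *) ᵀ ≡ (x *) ᵀ
    unfold = begin
      one ⊔ x ᵀ · (x *) ᵀ    ≡⟨ cong₂ _⊔_ (sym oneᵀ) (sym (ᵀ-· (x *) x)) ⟩
      one ᵀ ⊔ (x * · x) ᵀ    ≡⟨ sym (ᵀ-⊔ one (x * · x)) ⟩
      (one ⊔ x * · x) ᵀ      ≡⟨ cong _ᵀ (star-unfoldʳ x) ⟩
      (x *) ᵀ                ∎
      where open ≡-Reasoning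

  ᵀstarᵀ⊑star : ∀ x → ((x ᵀ) *) ᵀ ⊑ x *
  ᵀstarᵀ⊑star x = subst (((x ᵀ) *) ᵀ ⊑_) (ᵀ-involutive (x *)) (ᵀ-mono (starᵀ⊑ᵀstar x))

  injective-⊓ᵀ⊑star : ∀ {p w y} → injective w → vector w → vector y →
                      y ⊑ (p ᵀ) * · w → w ⊓ y ᵀ ⊑ p *
  injective-⊓ᵀ⊑star {p} {w} {y} w-inj w-vec y-vec y⊑ =
    ⊑-trans (vector-⊓ᵀ⊑· w-vec y-vec)
      (⊑-trans (·-monoʳ w yᵀ⊑)
        (⊑-trans (⊑-reflexive (sym (·-assoc w (w ᵀ) (p *))))
          (⊑-trans (·-monoˡ (p *) w-inj) (⊑-reflexive (·-identityˡ (p *))))))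
    where
    yᵀ⊑ : y ᵀ ⊑ w ᵀ · p *
    yᵀ⊑ = ⊑-trans (ᵀ-mono y⊑)
            (subst (_⊑ w ᵀ · p *) (sym (ᵀ-· ((p ᵀ) *) w)) (·-monoʳ (w ᵀ) (ᵀstarᵀ⊑star p)))

theorem10p1 : {c : Level} (K : KleeneRelationAlgebra c) →
    let open KleeneRelationAlgebra K in
    tarski → (p w y : S) →
    acyclic (p ⊓ ∁ one) →
    point w → point y →
    y ⊑ (((p ᵀ) *) · w) →
    acyclic (((w ⊓ (y ᵀ)) ⊔ (∁ w ⊓ p)) ⊓ ∁ one)
theorem10p1 K _ p w y r-acyclic (w-inj , _ , w-vec) (_ , _ , y-vec) y⊑ =
  ⊑-trans (plus-least r q⊑r⁺) r-acyclic
  where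
  open KleeneRelationAlgebraProperties K
  r : S
  r = p ⊓ ∁ one
  q⊑r⁺ : ((w ⊓ y ᵀ) ⊔ (∁ w ⊓ p)) ⊓ ∁ one ⊑ r ⁺
  q⊑r⁺ = subst (_⊑ r ⁺) (sym (⊓-distribʳ-⊔ (∁ one) (w ⊓ y ᵀ) (∁ w ⊓ p)))
    (⊔-lub (⊑-trans (⊓-monoˡ (∁ one) (⊑-trans (injective-⊓ᵀ⊑star w-inj w-vec y-vec y⊑)
                                              (star-⊑-star-⊓∁one p)))
                    (star-⊓∁one⊑plus r))
           (⊑-trans (⊓-monoˡ (∁ one) (⊓-lowerʳ (∁ w) p)) (⊑-plus r)))
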